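{- For every $n>0$, $\mathcal{D}_n^A$ is isomorphic to the lattice $\mathcal{I}\bigl((T_n^A,\le)\bigr)$ of order ideals of $(T_n^A,\le)$ ordered by inclusion, and $\mathcal{D}_n^B$ is isomorphic to $\mathcal{I}\bigl((T_n^B,\le)\bigr)$, where $T_n^A=\{(i,j)\mid 1\le i<j\le n\}$, $T_n^B=\{(i,j)\mid 1\le i<j\le 2n+1-i\}$, and $(a,b)\le(a',b')$ iff $a\ge a'$ and $b\le b'$.
   Context: $D_n^B$ is the set of words of length $2n$ over $\{u,r\}$ in which every prefix has at least as many $u$'s as $r$'s; $D_n^A\subseteq D_n^B$ consists of those with exactly $n$ letters $u$. Height sequence of $w\in D_n^B$: let $\rho$ be the number of $r$'s. If $w$ ends with $r$, $k=\rho$ and $h_i$ is the number of $u$'s preceding the $i$-th $r$; if $w$ ends with $u$, $k=\rho+1$, $h_i$ ($i\le\rho$) as before and $h_k$ is the total number of $u$'s. Dominance order $\leq_D$: $(h_1,\dots,h_k)\le_D(h'_1,\dots,h'_{k'})$ iff $k\ge k'$ and $h_i\le h'_i$ for $i\in[k']$; on $D_n^A$ (where $k=n$) this is componentwise comparison. $\mathcal{D}_n^A=(D_n^A,\le_D)$, $\mathcal{D}_n^B=(D_n^B,\le_D)$. -}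

module Defs where

open import Data.Nat using (ℕ; zero; suc; _+_; _*_; _∸_; _≤_; _<_; _≥_)
open import Data.Bool using (Bool; true; false)
open import Data.List using (List; []; _∷_; length; take)
open import Data.Product using (Σ; _×_; proj₁)
open import Data.Unit using (⊤)
open import Relation.Binary.PropositionalEquality using (_≡_)

data Letter : Set where
  u r : Letter

Word : Set
Word = List Letter

#u : Word → ℕ
#u []      = 0
#u (u ∷ w) = suc (#u w)
#u (r ∷ w) = #u w

#r : Word → ℕ
#r []      = 0
#r (u ∷ w) = #r w
#r (r ∷ w) = suc (#r w)

Ballot : Word → Set
Ballot w = ∀ k → #r (take k w) ≤ #u (take k w)

IsDB : ℕ → Word → Set
IsDB n w = length w ≡ 2 * n × Ballot w

IsDA : ℕ → Word → Set
IsDA n w = IsDB n w × #u w ≡ n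

DB : ℕ → Set
DB n = Σ Word (IsDB n)

DA : ℕ → Set
DA n = Σ Word (IsDA n)

-- Height sequence.  hs c w : c = number of u's read so far.
-- At each r we output the number of preceding u's; if the word ends
-- with u, we finally output the total number of u's.
hs : ℕ → Word → List ℕ
hs c []          = []
hs c (u ∷ [])    = suc c ∷ []
hs c (u ∷ x ∷ w) = hs (suc c) (x ∷ w)
hs c (r ∷ w)     = c ∷ hs c w

heights : Word → List ℕ
heights = hs 0

-- Dominance order: (h_1..h_k) ≤D (h'_1..h'_k') iff k ≥ k' and
-- h_i ≤ h'_i for i ∈ [k'].
data _≤D_ : List ℕ → List ℕ → Set where
  dom-[] : ∀ {h} → h ≤D []
  dom-∷  : ∀ {a b h h'} → a ≤ b → h ≤D h' → (a ∷ h) ≤D (b ∷ h')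

_≈W_ : ∀ {P : Word → Set} → Σ Word P → Σ Word P → Set
x ≈W y = proj₁ x ≡ proj₁ y

_≤W_ : ∀ {P : Word → Set} → Σ Word P → Σ Word P → Set
x ≤W y = heights (proj₁ x) ≤D heights (proj₁ y)

TA : ℕ → ℕ → ℕ → Set
TA n i j = 1 ≤ i × i < j × j ≤ n

TB : ℕ → ℕ → ℕ → Set
TB n i j = 1 ≤ i × i < j × j ≤ (2 * n + 1) ∸ i

_⊑_ : ℕ × ℕ → ℕ × ℕ → Set
_⊑_ = λ p q → (Data.Product.proj₁ p ≥ Data.Product.proj₁ q)
             × (Data.Product.proj₂ p ≤ Data.Product.proj₂ q)

record Ideal (T : ℕ → ℕ → Set) : Set where
  field
    mem       : ℕ → ℕ → Bool
    support   : ∀ i j → mem i j ≡ true → T i j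
    downClose : ∀ i j i' j' → mem i j ≡ true → T i' j' →
                (i' Data.Product., j') ⊑ (i Data.Product., j) → mem i' j' ≡ true
open Ideal public

_≈I_ : ∀ {T} → Ideal T → Ideal T → Set
I ≈I J = ∀ i j → mem I i j ≡ mem J i j

_⊆I_ : ∀ {T} → Ideal T → Ideal T → Set
I ⊆I J = ∀ i j → mem I i j ≡ true → mem J i j ≡ true

-- Send a word w to the set of cells (i , j) such that after i - 1 + j letters w
-- has read at least j letters u.  This set is an order ideal, and the map is an
-- order embedding because the dominance order on height sequences is the reverse
-- comparison of the numbers of letters r in all prefixes.  Conversely, an ideal J
-- is the image of the greedy word that plays u exactly when the cell this u
-- adds belongs to J (or when r would break the ballot condition); induction over
-- the cells shows that the ideal of this word is J.  In type A every cell has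
-- j ≤ n, which caps the number of letters u of every prefix at n, so the greedy
-- word has exactly n of them.
module Submission where

open import Defs
open import Data.Nat
open import Data.Nat.Properties
open import Data.Bool using (true; false)
import Data.Bool.Properties as Bool
open import Data.List using (List; []; _∷_; length; take; _++_; _∷ʳ_)
open import Data.List.Properties using (take-all; ∷ʳ-++; length-++)
open import Data.List.Relation.Unary.All as All using (All; []; _∷_)
open import Data.List.Relation.Unary.All.Properties using (∷ʳ⁺)
open import Data.Product using (Σ; _×_; _,_; proj₁; proj₂)
open import Data.Sum using (_⊎_; inj₁; inj₂)
open import Function using (_⇔_; mk⇔; Equivalence; case_of_; _∘_)
open import Relation.Nullary using (¬_; Dec; yes; no; does; contradiction)
open import Relation.Nullary.Decidable using (dec-true; dec-false; _×-dec_; _⊎-dec_)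
open import Relation.Binary.Definitions using (tri<; tri≈; tri>)
open import Relation.Binary.PropositionalEquality
open import Relation.Binary.Morphism.Structures using (IsOrderIsomorphism)
open import Algebra.Properties.CommutativeSemigroup +-commutativeSemigroup using (xy∙z≈xz∙y)

double-≤⇒≤ : ∀ {a b} → a + a ≤ b + suc b → a ≤ b
double-≤⇒≤ le = ≮⇒≥ λ b<a → n≮n _ (≤-trans (+-mono-≤ b<a b<a) le)

+-suc-≤ : ∀ {a b d} → a ≤ d + suc b → a ≤ suc (d + b)
+-suc-≤ {b = b} {d} le = ≤-trans le (≤-reflexive (+-suc d b))

≤-+-suc : ∀ {a b d} → a ≤ suc (d + b) → a ≤ d + suc b
≤-+-suc {b = b} {d} le = ≤-trans le (≤-reflexive (sym (+-suc d b)))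

2*n≡n+n : ∀ n → 2 * n ≡ n + n
2*n≡n+n n = cong (n +_) (+-identityʳ n)

length-∷ʳ : ∀ {A : Set} (xs : List A) x → length (xs ∷ʳ x) ≡ suc (length xs)
length-∷ʳ xs x = trans (length-++ xs) (+-comm (length xs) 1)

#r-take≤ : ∀ m w → #r (take m w) ≤ m
#r-take≤ zero    w       = z≤n
#r-take≤ (suc m) []      = z≤n
#r-take≤ (suc m) (u ∷ w) = m≤n⇒m≤1+n (#r-take≤ m w)
#r-take≤ (suc m) (r ∷ w) = s≤s (#r-take≤ m w)

#r-take-mono : ∀ w {m m'} → m ≤ m' → #r (take m w) ≤ #r (take m' w)
#r-take-mono w       z≤n       = z≤n
#r-take-mono []      (s≤s m≤m') = z≤n
#r-take-mono (u ∷ w) (s≤s m≤m') = #r-take-mono w m≤m'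
#r-take-mono (r ∷ w) (s≤s m≤m') = s≤s (#r-take-mono w m≤m')

#r-take-+ : ∀ m k w → #r (take (m + k) w) ≤ #r (take m w) + k
#r-take-+ zero    k w       = #r-take≤ k w
#r-take-+ (suc m) k []      = z≤n
#r-take-+ (suc m) k (u ∷ w) = #r-take-+ m k w
#r-take-+ (suc m) k (r ∷ w) = s≤s (#r-take-+ m k w)

#r-take+#u-take : ∀ m w → m ≤ length w → #r (take m w) + #u (take m w) ≡ m
#r-take+#u-take zero    w       _         = refl
#r-take+#u-take (suc m) (u ∷ w) (s≤s m≤l) = trans (+-suc _ _) (cong suc (#r-take+#u-take m w m≤l))
#r-take+#u-take (suc m) (r ∷ w) (s≤s m≤l) = cong suc (#r-take+#u-take m w m≤l)

#u-take≤#u : ∀ m w → #u (take m w) ≤ #u w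
#u-take≤#u zero    w       = z≤n
#u-take≤#u (suc m) []      = z≤n
#u-take≤#u (suc m) (u ∷ w) = s≤s (#u-take≤#u m w)
#u-take≤#u (suc m) (r ∷ w) = #u-take≤#u m w

#r-take-injective : ∀ w w' → length w ≡ length w' →
                    (∀ m → #r (take m w) ≡ #r (take m w')) → w ≡ w'
#r-take-injective []      []       _  _ = refl
#r-take-injective (u ∷ w) (u ∷ w') lw eq =
  cong (u ∷_) (#r-take-injective w w' (cong pred lw) (λ m → eq (suc m)))
#r-take-injective (r ∷ w) (r ∷ w') lw eq =
  cong (r ∷_) (#r-take-injective w w' (cong pred lw) (λ m → cong pred (eq (suc m))))
#r-take-injective (u ∷ w) (r ∷ w') _  eq with eq 1
... | ()
#r-take-injective (r ∷ w) (u ∷ w') _  eq with eq 1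
... | ()

ballot-from-double-#r : ∀ w → (∀ m → m ≤ length w → #r (take m w) + #r (take m w) ≤ m) → Ballot w
ballot-from-double-#r w double m = case m ≤? length w of λ where
    (yes m≤l) → #r≤#u m m≤l
    (no m≰l)  → subst (λ v → #r v ≤ #u v) (sym (take-all m w (<⇒≤ (≰⇒> m≰l))))
                      (subst (λ v → #r v ≤ #u v) (take-all (length w) w ≤-refl) (#r≤#u (length w) ≤-refl))
  where
  #r≤#u : ∀ m → m ≤ length w → #r (take m w) ≤ #u (take m w)
  #r≤#u m m≤l = +-cancelˡ-≤ _ _ _
    (≤-trans (double m m≤l) (≤-reflexive (sym (#r-take+#u-take m w m≤l))))

#r-take-shift : ∀ w {a a' j j'} → a ≤ a' → j' ≤ j →
                #r (take (a + j) w) ≤ a → #r (take (a' + j') w) ≤ a'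
#r-take-shift w {a} {j = j} {j'} a≤a' j'≤j bound with m≤n⇒∃[o]m+o≡n a≤a'
... | d , refl = begin
  #r (take (a + d + j') w) ≤⟨ #r-take-mono w (≤-trans (+-monoʳ-≤ (a + d) j'≤j)
                                                      (≤-reflexive (xy∙z≈xz∙y a d j))) ⟩
  #r (take (a + j + d) w)  ≤⟨ #r-take-+ (a + j) d w ⟩
  #r (take (a + j) w) + d  ≤⟨ +-monoˡ-≤ d bound ⟩
  a + d                    ∎
  where open ≤-Reasoning

_≼_ : Word → Word → Set
w ≼ w' = ∀ m → #r (take m w') ≤ #r (take m w)

hs-≤D-∷⇒≤ : ∀ {c b l} z w → hs c (z ∷ w) ≤D (b ∷ l) → c ≤ b
hs-≤D-∷⇒≤ u []      (dom-∷ le _) = <⇒≤ le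
hs-≤D-∷⇒≤ u (z ∷ w) le           = <⇒≤ (hs-≤D-∷⇒≤ z w le)
hs-≤D-∷⇒≤ r w       (dom-∷ le _) = le

-- Reading w and w' in lockstep, Q holds the heights already emitted by w that
-- still await their partners in w' (w has read d more letters r than w'); they
-- are bounded by the current u-count c of w, hence below all heights still to
-- come from w'.
≤D⇒≼-pending : ∀ {c d} Q → All (_≤ c) Q → length Q ≡ d → ∀ w w' → length w ≡ length w' →
               (Q ++ hs c w) ≤D hs (d + c) w' → ∀ m → #r (take m w') ≤ d + #r (take m w)
≤D⇒≼-pending _ _ _ _ _ _ _ zero = z≤n
≤D⇒≼-pending _ _ _ [] [] _ _ (suc m) = z≤n
≤D⇒≼-pending {d = d} _ _ _ (u ∷ []) (u ∷ []) _ _ (suc m) = m≤n+m _ d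
≤D⇒≼-pending {c} [] _ refl (u ∷ []) (r ∷ []) _ (dom-∷ c<c _) (suc m) = contradiction c<c (n≮n c)
≤D⇒≼-pending (_ ∷ _) _ refl (u ∷ []) (r ∷ []) _ _ (suc m) = s≤s (m≤n+m _ _)
≤D⇒≼-pending {d = d} _ _ _ (r ∷ []) (u ∷ []) _ _ (suc m) = ≤-trans (n≤1+n _) (m≤n+m _ d)
≤D⇒≼-pending {c} Q Q≤c lq (u ∷ z ∷ w) (u ∷ z' ∷ w') lw le (suc m) =
  ≤D⇒≼-pending Q (All.map m≤n⇒m≤1+n Q≤c) lq (z ∷ w) (z' ∷ w') (cong pred lw)
    (subst (λ k → (Q ++ hs (suc c) (z ∷ w)) ≤D hs k (z' ∷ w')) (sym (+-suc _ c)) le) m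
≤D⇒≼-pending [] _ refl (r ∷ w) (r ∷ w') lw (dom-∷ _ le) (suc m) =
  s≤s (≤D⇒≼-pending [] [] refl w w' (cong pred lw) le m)
≤D⇒≼-pending {c} (_ ∷ Q) (_ ∷ Q≤c) refl (r ∷ w) (r ∷ w') lw (dom-∷ _ le) (suc m) =
  ≤-+-suc {d = suc (length Q)}
    (s≤s (≤D⇒≼-pending (Q ∷ʳ c) (∷ʳ⁺ Q≤c ≤-refl) (length-∷ʳ Q c) w w' (cong pred lw)
            (subst (_≤D _) (sym (∷ʳ-++ Q c (hs c w))) le) m))
≤D⇒≼-pending [] _ refl (u ∷ z ∷ w) (r ∷ w') _ le (suc m) =
  contradiction (hs-≤D-∷⇒≤ z w le) (n≮n _)
≤D⇒≼-pending {c} (_ ∷ Q) (_ ∷ Q≤c) refl (u ∷ z ∷ w) (r ∷ w') lw (dom-∷ _ le) (suc m) =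
  s≤s (≤D⇒≼-pending Q (All.map m≤n⇒m≤1+n Q≤c) refl (z ∷ w) w' (cong pred lw)
         (subst (λ k → (Q ++ hs (suc c) (z ∷ w)) ≤D hs k w') (sym (+-suc _ c)) le) m)
≤D⇒≼-pending {c} Q Q≤c lq (r ∷ w) (u ∷ z' ∷ w') lw le (suc m) =
  ≤-+-suc (≤D⇒≼-pending (Q ∷ʳ c) (∷ʳ⁺ Q≤c ≤-refl) (trans (length-∷ʳ Q c) (cong suc lq)) w (z' ∷ w')
             (cong pred lw) (subst (_≤D _) (sym (∷ʳ-++ Q c (hs c w))) le) m)

≼⇒≤D-pending : ∀ {c d} Q → All (_≤ c) Q → length Q ≡ d → ∀ w w' → length w ≡ length w' →
               (∀ m → #r (take m w') ≤ d + #r (take m w)) → (Q ++ hs c w) ≤D hs (d + c) w'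
≼⇒≤D-pending _ _ _ [] [] _ _ = dom-[]
≼⇒≤D-pending [] _ refl (u ∷ []) (u ∷ []) _ _ = dom-∷ ≤-refl dom-[]
≼⇒≤D-pending {c} (_ ∷ Q) (q≤c ∷ _) refl (u ∷ []) (u ∷ []) _ _ =
  dom-∷ (≤-trans q≤c (m≤n+m c (2 + length Q))) dom-[]
≼⇒≤D-pending [] _ refl (u ∷ []) (r ∷ []) _ dom with dom 1
... | ()
≼⇒≤D-pending (_ ∷ _) (q≤c ∷ _) refl (u ∷ []) (r ∷ []) _ _ = dom-∷ (≤-trans q≤c (m≤n+m _ _)) dom-[]
≼⇒≤D-pending [] _ refl (r ∷ []) (u ∷ []) _ _ = dom-∷ (n≤1+n _) dom-[]
≼⇒≤D-pending {c} (_ ∷ Q) (q≤c ∷ _) refl (r ∷ []) (u ∷ []) _ _ =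
  dom-∷ (≤-trans q≤c (m≤n+m c (2 + length Q))) dom-[]
≼⇒≤D-pending {c} Q Q≤c lq (u ∷ z ∷ w) (u ∷ z' ∷ w') lw dom =
  subst (λ k → (Q ++ hs (suc c) (z ∷ w)) ≤D hs k (z' ∷ w')) (+-suc _ c)
    (≼⇒≤D-pending Q (All.map m≤n⇒m≤1+n Q≤c) lq (z ∷ w) (z' ∷ w') (cong pred lw) (λ m → dom (suc m)))
≼⇒≤D-pending [] _ refl (r ∷ w) (r ∷ w') lw dom =
  dom-∷ ≤-refl (≼⇒≤D-pending [] [] refl w w' (cong pred lw) (λ m → ≤-pred (dom (suc m))))
≼⇒≤D-pending {c} (_ ∷ Q) (q≤c ∷ Q≤c) refl (r ∷ w) (r ∷ w') lw dom =
  dom-∷ (≤-trans q≤c (m≤n+m _ _))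
    (subst (_≤D _) (∷ʳ-++ Q c (hs c w))
      (≼⇒≤D-pending (Q ∷ʳ c) (∷ʳ⁺ Q≤c ≤-refl) (length-∷ʳ Q c) w w' (cong pred lw)
        (λ m → ≤-pred (+-suc-≤ {d = suc (length Q)} (dom (suc m))))))
≼⇒≤D-pending [] _ refl (u ∷ z ∷ w) (r ∷ w') _ dom with dom 1
... | ()
≼⇒≤D-pending {c} (_ ∷ Q) (q≤c ∷ Q≤c) refl (u ∷ z ∷ w) (r ∷ w') lw dom =
  dom-∷ (≤-trans q≤c (m≤n+m _ _))
    (subst (λ k → (Q ++ hs (suc c) (z ∷ w)) ≤D hs k w') (+-suc _ c)
      (≼⇒≤D-pending Q (All.map m≤n⇒m≤1+n Q≤c) refl (z ∷ w) w' (cong pred lw)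
        (λ m → ≤-pred (dom (suc m)))))
≼⇒≤D-pending {c} Q Q≤c lq (r ∷ w) (u ∷ z' ∷ w') lw dom =
  subst (_≤D _) (∷ʳ-++ Q c (hs c w))
    (≼⇒≤D-pending (Q ∷ʳ c) (∷ʳ⁺ Q≤c ≤-refl) (trans (length-∷ʳ Q c) (cong suc lq)) w (z' ∷ w')
      (cong pred lw) (λ m → +-suc-≤ (dom (suc m))))

heights-≤D⇔≼ : ∀ w w' → length w ≡ length w' → heights w ≤D heights w' ⇔ w ≼ w'
heights-≤D⇔≼ w w' lw = mk⇔ (≤D⇒≼-pending [] [] refl w w' lw) (≼⇒≤D-pending [] [] refl w w' lw)

≼-from-prefixes : ∀ {w w'} → length w ≡ length w' →
                  (∀ m → m ≤ length w → #r (take m w') ≤ #r (take m w)) → w ≼ w'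
≼-from-prefixes {w} {w'} lw prefix m = case m ≤? length w of λ where
    (yes m≤l) → prefix m m≤l
    (no m≰l)  → let l≤m = <⇒≤ (≰⇒> m≰l) in
      subst₂ _≤_ (cong #r (sym (take-all m w' (subst (_≤ m) lw l≤m))))
                 (cong #r (sym (take-all m w l≤m))) whole
  where
  whole : #r w' ≤ #r w
  whole = subst₂ _≤_ (cong #r (take-all (length w) w' (≤-reflexive (sym lw))))
                     (cong #r (take-all (length w) w ≤-refl)) (prefix (length w) ≤-refl)

from-does : ∀ {A : Set} (a? : Dec A) → does a? ≡ true → A
from-does (yes a) _ = a

module WordIdeal (bd : ℕ → ℕ) where

  Cell : ℕ → ℕ → Set
  Cell i j = 1 ≤ i × i < j × j ≤ bd i

  InIdeal : Word → ℕ → ℕ → Set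
  InIdeal w i j = Cell i j × #r (take (pred i + j) w) < i

  inIdeal? : ∀ w i j → Dec (InIdeal w i j)
  inIdeal? w i j = (1 ≤? i ×-dec i <? j ×-dec j ≤? bd i) ×-dec suc (#r (take (pred i + j) w)) ≤? i

  inIdeal-downClosed : ∀ w {i j i' j'} → Cell i' j' → (i' , j') ⊑ (i , j) → InIdeal w i j → InIdeal w i' j'
  inIdeal-downClosed w {suc a} {i' = suc a'} cell' (s≤s a≤a' , j'≤j) (_ , s≤s below) =
    cell' , s≤s (#r-take-shift w a≤a' j'≤j below)

  idealOf : Word → Ideal Cell
  idealOf w = record
    { mem       = λ i j → does (inIdeal? w i j)
    ; support   = λ i j e → proj₁ (from-does (inIdeal? w i j) e)
    ; downClose = λ i j i' j' e cell' le → dec-true (inIdeal? w i' j')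
                    (inIdeal-downClosed w cell' le (from-does (inIdeal? w i j) e))
    }

  idealOf-mono : ∀ {w w'} → w ≼ w' → idealOf w ⊆I idealOf w'
  idealOf-mono {w} {w'} w≼w' i j e with from-does (inIdeal? w i j) e
  ... | cell , below = dec-true (inIdeal? w' i j) (cell , ≤-<-trans (w≼w' (pred i + j)) below)

  WithinBound : Word → Set
  WithinBound w = ∀ m → m ≤ length w → #u (take m w) ≤ bd (suc (#r (take m w)))

  -- A prefix of w with a letters r and b letters u exhibits the cell (a + 1, b)
  -- of its ideal when a + 1 < b; otherwise the ballot condition on w' suffices.
  idealOf-reflects : ∀ {w w'} → length w ≡ length w' → WithinBound w → Ballot w' →
                     idealOf w ⊆I idealOf w' → w ≼ w'
  idealOf-reflects {w} {w'} lw bound ballot' sub = ≼-from-prefixes lw prefix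
    where
    prefix : ∀ m → m ≤ length w → #r (take m w') ≤ #r (take m w)
    prefix m m≤l = case suc a <? b of λ where
        (yes a<b) → let (_ , below) = from-does (inIdeal? w' (suc a) b)
                                        (sub (suc a) b (dec-true (inIdeal? w (suc a) b) (cell∈w a<b)))
                    in ≤-pred (subst (λ k → #r (take k w') < suc a) a+b≡m below)
        (no a≮b)  → double-≤⇒≤ (begin
          a' + a'             ≤⟨ +-monoʳ-≤ a' (ballot' m) ⟩
          a' + #u (take m w') ≡⟨ #r-take+#u-take m w' (subst (m ≤_) lw m≤l) ⟩
          m                   ≡⟨ sym a+b≡m ⟩
          a + b               ≤⟨ +-monoʳ-≤ a (≮⇒≥ a≮b) ⟩
          a + suc a           ∎)
      where
      open ≤-Reasoning
      a = #r (take m w)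
      b = #u (take m w)
      a' = #r (take m w')
      a+b≡m : a + b ≡ m
      a+b≡m = #r-take+#u-take m w m≤l
      cell∈w : suc a < b → InIdeal w (suc a) b
      cell∈w a<b = (s≤s z≤n , a<b , bound m m≤l) , subst (λ k → #r (take k w) < suc a) (sym a+b≡m) ≤-refl

  idealOf-injective : ∀ {w w'} → length w ≡ length w' → WithinBound w → WithinBound w' →
                      Ballot w → Ballot w' → idealOf w ≈I idealOf w' → w ≡ w'
  idealOf-injective {w} {w'} lw bound bound' ballot ballot' same =
    #r-take-injective w w' lw λ m → ≤-antisym
      (idealOf-reflects (sym lw) bound' ballot (λ i j → trans (same i j)) m)
      (idealOf-reflects lw bound ballot' (λ i j → trans (sym (same i j))) m)

  -- Position m, preceded by c letters r, gets the letter u exactly when the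
  -- cell (c + 1 , m + 1 - c) it would put into the ideal belongs to J, or when
  -- the letter r would violate the ballot condition.
  module Greedy (bd-antitone : ∀ {i i'} → i ≤ i' → bd i' ≤ bd i) (J : Ideal Cell) where

    PrefersU : ℕ → ℕ → Set
    PrefersU m c = mem J (suc c) (suc m ∸ c) ≡ true ⊎ m ≤ c + c

    prefersU? : ∀ m c → Dec (PrefersU m c)
    prefersU? m c = mem J (suc c) (suc m ∸ c) Bool.≟ true ⊎-dec m ≤? c + c

    letter : ∀ {P : Set} → Dec P → Letter
    letter (yes _) = u
    letter (no _)  = r

    rCount : ℕ → ℕ
    rCount zero    = 0
    rCount (suc m) = #r (letter (prefersU? m (rCount m)) ∷ []) + rCount m

    letters : ℕ → ℕ → Word
    letters zero    m = []
    letters (suc k) m = letter (prefersU? m (rCount m)) ∷ letters k (suc m)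

    rCount-step : ∀ m → (PrefersU m (rCount m) × rCount (suc m) ≡ rCount m)
                      ⊎ (¬ PrefersU m (rCount m) × rCount (suc m) ≡ suc (rCount m))
    rCount-step m = step (prefersU? m (rCount m))
      where
      step : ∀ {P} (p? : Dec P) → (P × #r (letter p? ∷ []) + rCount m ≡ rCount m)
                                ⊎ (¬ P × #r (letter p? ∷ []) + rCount m ≡ suc (rCount m))
      step (yes p) = inj₁ (p , refl)
      step (no ¬p) = inj₂ (¬p , refl)

    rCount-double≤ : ∀ m → rCount m + rCount m ≤ m
    rCount-double≤ zero = z≤n
    rCount-double≤ (suc m) with rCount-step m
    ... | inj₁ (_ , stays) rewrite stays = m≤n⇒m≤1+n (rCount-double≤ m)
    ... | inj₂ (¬prefers , grows) rewrite grows =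
      s≤s (≤-trans (≤-reflexive (+-suc _ _)) (≰⇒> (λ m≤ → ¬prefers (inj₂ m≤))))

    rCount-≤-suc : ∀ m → rCount m ≤ rCount (suc m)
    rCount-≤-suc m with rCount-step m
    ... | inj₁ (_ , stays) = ≤-reflexive (sym stays)
    ... | inj₂ (_ , grows) = ≤-trans (n≤1+n _) (≤-reflexive (sym grows))

    rCount-suc-≤ : ∀ m → rCount (suc m) ≤ suc (rCount m)
    rCount-suc-≤ m with rCount-step m
    ... | inj₁ (_ , stays) = ≤-trans (≤-reflexive stays) (n≤1+n _)
    ... | inj₂ (_ , grows) = ≤-reflexive grows

    length-letters : ∀ k m → length (letters k m) ≡ k
    length-letters zero    m = refl
    length-letters (suc k) m = cong suc (length-letters k (suc m))

    #r-take-letters : ∀ t k m → t ≤ k → #r (take t (letters k m)) + rCount m ≡ rCount (t + m)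
    #r-take-letters zero    k       m _         = refl
    #r-take-letters (suc t) (suc k) m (s≤s t≤k) = begin
      #r (x ∷ take t (letters k (suc m))) + rCount m   ≡⟨ #r-∷-+ x _ (rCount m) ⟩
      #r (take t (letters k (suc m))) + rCount (suc m) ≡⟨ #r-take-letters t k (suc m) t≤k ⟩
      rCount (t + suc m)                               ≡⟨ cong rCount (+-suc t m) ⟩
      rCount (suc t + m)                               ∎
      where
      open ≡-Reasoning
      x = letter (prefersU? m (rCount m))
      #r-∷-+ : ∀ z v c → #r (z ∷ v) + c ≡ #r v + (#r (z ∷ []) + c)
      #r-∷-+ u v c = refl
      #r-∷-+ r v c = sym (+-suc (#r v) c)

    prefersU-diagonal : ∀ a j → a < j → PrefersU (a + j) a ⇔ mem J (suc a) (suc j) ≡ true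
    prefersU-diagonal a j a<j = mk⇔ from-prefers (inj₁ ∘ subst (λ k → mem J (suc a) k ≡ true) (sym column))
      where
      column : suc (a + j) ∸ a ≡ suc j
      column = trans (cong (_∸ a) (sym (+-suc a j))) (m+n∸m≡n a (suc j))
      from-prefers : PrefersU (a + j) a → mem J (suc a) (suc j) ≡ true
      from-prefers (inj₁ memJ) = subst (λ k → mem J (suc a) k ≡ true) column memJ
      from-prefers (inj₂ a+j≤a+a) = contradiction (+-cancelˡ-≤ a j a a+j≤a+a) (<⇒≱ a<j)

    mem⇔rCount≤-diagonal : ∀ a j → a < j → rCount (a + j) ≡ a →
                           mem J (suc a) (suc j) ≡ true ⇔ rCount (suc (a + j)) ≤ a
    mem⇔rCount≤-diagonal a j a<j c≡a with rCount-step (a + j)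
    ... | inj₁ (prefers , stays) =
      mk⇔ (λ _ → ≤-reflexive (trans stays c≡a))
          (λ _ → Equivalence.to (prefersU-diagonal a j a<j) (subst (PrefersU (a + j)) c≡a prefers))
    ... | inj₂ (¬prefers , grows) =
      mk⇔ (λ memJ → contradiction (subst (PrefersU (a + j)) (sym c≡a)
                      (Equivalence.from (prefersU-diagonal a j a<j) memJ)) ¬prefers)
          (λ le → contradiction (subst (_≤ a) (trans grows (cong suc c≡a)) le) (n≮n a))

    -- rCount (a + j) ≤ a says that the cell (a + 1 , j) lies in the ideal of the
    -- greedy word; the next three lemmas show, by a joint induction on the cell,
    -- that this happens exactly when it lies in J.
    mem⇔rCount≤ : ∀ a j → suc a < j → j ≤ bd (suc a) → mem J (suc a) j ≡ true ⇔ rCount (a + j) ≤ a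
    mem⇒rCount≤ : ∀ a j → suc a < suc j → suc j ≤ bd (suc a) → mem J (suc a) (suc j) ≡ true →
                  rCount (a + j) ≤ a
    rCount<⇒mem : ∀ a j → suc (suc a) < suc j → suc j ≤ bd (suc (suc a)) → rCount (suc a + j) ≤ a →
                     mem J (suc (suc a)) (suc j) ≡ true

    mem⇔rCount≤ a (suc j) a<j j≤bd with <-cmp (rCount (a + j)) a
    mem⇔rCount≤ zero (suc j) a<j j≤bd | tri< () _ _
    mem⇔rCount≤ (suc a) (suc j) a<j j≤bd | tri< c<a _ _ =
      mk⇔ (λ _ → ≤-trans (≤-reflexive (cong rCount (+-suc (suc a) j))) (≤-trans (rCount-suc-≤ _) c<a))
          (λ _ → rCount<⇒mem a j a<j j≤bd (≤-pred c<a))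
    ... | tri≈ _ c≡a _ = subst (λ k → mem J (suc a) (suc j) ≡ true ⇔ rCount k ≤ a) (sym (+-suc a j))
                           (mem⇔rCount≤-diagonal a j (≤-pred a<j) c≡a)
    ... | tri> _ _ a<c =
      mk⇔ (λ memJ → contradiction (mem⇒rCount≤ a j a<j j≤bd memJ) (<⇒≱ a<c))
          (λ le → contradiction (≤-trans (rCount-≤-suc (a + j)) (subst (_≤ a) (cong rCount (+-suc a j)) le))
                                (<⇒≱ a<c))

    mem⇒rCount≤ a j a<j j≤bd memJ with suc a <? j
    ... | yes a<j' = Equivalence.to (mem⇔rCount≤ a j a<j' j'≤bd)
                       (downClose J (suc a) (suc j) (suc a) j memJ (s≤s z≤n , a<j' , j'≤bd) (≤-refl , n≤1+n j))
      where j'≤bd = ≤-trans (n≤1+n j) j≤bd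
    ... | no a≮j = double-≤⇒≤ (≤-trans (rCount-double≤ (a + j)) (+-monoʳ-≤ a (≮⇒≥ a≮j)))

    rCount<⇒mem a j a<j j≤bd c≤a =
      downClose J (suc a) (suc j) (suc (suc a)) (suc j)
        (Equivalence.from (mem⇔rCount≤ a (suc j) (<⇒≤ a<j) (≤-trans j≤bd (bd-antitone (n≤1+n _))))
          (subst (_≤ a) (cong rCount (sym (+-suc a j))) c≤a))
        (s≤s z≤n , a<j , j≤bd) (n≤1+n _ , ≤-refl)

    greedy : ℕ → Word
    greedy L = letters L 0

    #r-take-greedy : ∀ {L t} → t ≤ L → #r (take t (greedy L)) ≡ rCount t
    #r-take-greedy {L} {t} t≤L =
      trans (sym (+-identityʳ _)) (trans (#r-take-letters t L 0 t≤L) (cong rCount (+-identityʳ t)))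

    greedy-ballot : ∀ L → Ballot (greedy L)
    greedy-ballot L = ballot-from-double-#r (greedy L) λ m m≤l →
      subst (λ c → c + c ≤ m) (sym (#r-take-greedy (subst (m ≤_) (length-letters L 0) m≤l))) (rCount-double≤ m)

    module _ {L} (cells-fit : ∀ a j → suc a < j → j ≤ bd (suc a) → a + j ≤ L) where

      inIdeal-greedy⇔mem : ∀ i j → InIdeal (greedy L) i j ⇔ mem J i j ≡ true
      inIdeal-greedy⇔mem zero j =
        mk⇔ (λ { ((() , _) , _) }) (λ memJ → contradiction (proj₁ (support J 0 j memJ)) λ ())
      inIdeal-greedy⇔mem (suc a) j = mk⇔
        (λ { (cell@(_ , a<j , j≤bd) , s≤s below) → Equivalence.from (mem⇔rCount≤ a j a<j j≤bd)
               (subst (_≤ a) (#r-take-greedy (cells-fit a j a<j j≤bd)) below) })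
        (λ memJ → let cell@(_ , a<j , j≤bd) = support J (suc a) j memJ in
           cell , s≤s (subst (_≤ a) (sym (#r-take-greedy (cells-fit a j a<j j≤bd)))
                    (Equivalence.to (mem⇔rCount≤ a j a<j j≤bd) memJ)))

      idealOf-greedy : idealOf (greedy L) ≈I J
      idealOf-greedy i j with mem J i j in e
      ... | true  = dec-true (inIdeal? (greedy L) i j) (Equivalence.from (inIdeal-greedy⇔mem i j) e)
      ... | false = dec-false (inIdeal? (greedy L) i j)
                      (λ p → contradiction (trans (sym e) (Equivalence.to (inIdeal-greedy⇔mem i j) p)) λ ())

    module _ (n : ℕ) (bd≤n : ∀ i → bd i ≤ n) where

      m≤n+rCount : ∀ m → m ≤ 2 * n → m ≤ n + rCount m
      m≤n+rCount zero    _ = z≤n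
      m≤n+rCount (suc m) m<2n with rCount-step m
      ... | inj₂ (_ , grows) rewrite grows = ≤-+-suc (s≤s (m≤n+rCount m (<⇒≤ m<2n)))
      ... | inj₁ (inj₁ memJ , stays) rewrite stays = begin
        suc m                         ≡⟨ sym (m∸n+n≡m {suc m} {rCount m} c≤1+m) ⟩
        (suc m ∸ rCount m) + rCount m ≤⟨ +-monoˡ-≤ (rCount m) (≤-trans column≤bd (bd≤n _)) ⟩
        n + rCount m                  ∎
        where
        open ≤-Reasoning
        column≤bd = proj₂ (proj₂ (support J _ _ memJ))
        c≤1+m : rCount m ≤ suc m
        c≤1+m = ≤-trans (m≤m+n (rCount m) (rCount m)) (m≤n⇒m≤1+n (rCount-double≤ m))
      ... | inj₁ (inj₂ m≤c+c , stays) rewrite stays with n ≤? rCount m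
      ...   | yes n≤c = ≤-trans m<2n (≤-trans (≤-reflexive (2*n≡n+n n)) (+-monoʳ-≤ n n≤c))
      ...   | no n≰c = ≤-trans (s≤s m≤c+c) (+-monoˡ-≤ (rCount m) (≰⇒> n≰c))

      #u-greedy : #u (greedy (2 * n)) ≡ n
      #u-greedy = +-cancelˡ-≡ n _ _ (begin
        n + #u g                                  ≡⟨ cong (_+ #u g) (sym c≡n) ⟩
        rCount (2 * n) + #u g                     ≡⟨ cong₂ _+_ (sym (#r-take-greedy {2 * n} ≤-refl))
                                                               (cong #u (sym whole)) ⟩
        #r (take (2 * n) g) + #u (take (2 * n) g) ≡⟨ #r-take+#u-take (2 * n) g (≤-reflexive (sym l≡2n)) ⟩
        2 * n                                     ≡⟨ 2*n≡n+n n ⟩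
        n + n                                     ∎)
        where
        open ≡-Reasoning
        g = greedy (2 * n)
        l≡2n : length g ≡ 2 * n
        l≡2n = length-letters (2 * n) 0
        whole : take (2 * n) g ≡ g
        whole = take-all (2 * n) g (≤-reflexive l≡2n)
        c≡n : rCount (2 * n) ≡ n
        c≡n = ≤-antisym
          (double-≤⇒≤ (≤-trans (rCount-double≤ (2 * n))
                                (≤-trans (≤-reflexive (2*n≡n+n n)) (+-monoʳ-≤ n (n≤1+n n)))))
          (+-cancelˡ-≤ n n _ (≤-trans (≤-reflexive (sym (2*n≡n+n n))) (m≤n+rCount (2 * n) ≤-refl)))

  isOrderIsomorphism : ∀ {P : Word → Set} L → (∀ {w} → P w → length w ≡ L) →
                       (∀ {w} → P w → Ballot w) → (∀ {w} → P w → WithinBound w) →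
                       (∀ J → Σ Word λ w → P w × idealOf w ≈I J) →
                       IsOrderIsomorphism _≈W_ _≈I_ _≤W_ _⊆I_ (λ (x : Σ Word P) → idealOf (proj₁ x))
  isOrderIsomorphism {P} L len ballot bound preimage = record
    { isOrderMonomorphism = record
      { isOrderHomomorphism = record
        { cong = λ same i j → cong (λ w → mem (idealOf w) i j) same
        ; mono = λ {x} {y} le → idealOf-mono (Equivalence.to (heights-≤D⇔≼ _ _ (same-length x y)) le)
        }
      ; injective = λ {x} {y} → idealOf-injective (same-length x y) (bound (proj₂ x)) (bound (proj₂ y))
                                  (ballot (proj₂ x)) (ballot (proj₂ y))
      ; cancel = λ {x} {y} sub → Equivalence.from (heights-≤D⇔≼ _ _ (same-length x y))
                   (idealOf-reflects (same-length x y) (bound (proj₂ x)) (ballot (proj₂ y)) sub)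
      }
    ; surjective = λ J → let (w , p , w≈J) = preimage J in
        (w , p) , λ same i j → trans (cong (λ v → mem (idealOf v) i j) same) (w≈J i j)
    }
    where
    same-length : ∀ (x y : Σ Word P) → length (proj₁ x) ≡ length (proj₁ y)
    same-length x y = trans (len (proj₂ x)) (sym (len (proj₂ y)))

module TypeA (n : ℕ) where
  open WordIdeal (λ _ → n)

  cells-fit : ∀ a j → suc a < j → j ≤ n → a + j ≤ 2 * n
  cells-fit a j a<j j≤n = ≤-trans (+-mono-≤ (≤-trans (≤-trans (n≤1+n a) (<⇒≤ a<j)) j≤n) j≤n)
                                  (≤-reflexive (sym (2*n≡n+n n)))

  within-bound : ∀ {w} → IsDA n w → WithinBound w
  within-bound (_ , #u≡n) m _ = ≤-trans (#u-take≤#u m _) (≤-reflexive #u≡n)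

  preimage : ∀ J → Σ Word λ w → IsDA n w × idealOf w ≈I J
  preimage J = greedy (2 * n) , ((length-letters _ 0 , greedy-ballot _) , #u-greedy n (λ _ → ≤-refl))
                              , idealOf-greedy cells-fit
    where open Greedy (λ _ → ≤-refl) J

  isOrderIsomorphismA : IsOrderIsomorphism _≈W_ _≈I_ _≤W_ _⊆I_ (λ (x : DA n) → idealOf (proj₁ x))
  isOrderIsomorphismA = isOrderIsomorphism (2 * n) (proj₁ ∘ proj₁) (proj₂ ∘ proj₁) within-bound preimage

module TypeB (n : ℕ) where
  open WordIdeal (λ i → 2 * n + 1 ∸ i)

  2n+1∸suc : ∀ a → 2 * n + 1 ∸ suc a ≡ 2 * n ∸ a
  2n+1∸suc a = cong (_∸ suc a) (+-comm (2 * n) 1)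

  cells-fit : ∀ a j → suc a < j → j ≤ 2 * n + 1 ∸ suc a → a + j ≤ 2 * n
  cells-fit a j a<j j≤bd with a ≤? 2 * n
  ... | yes a≤2n = ≤-trans (≤-reflexive (+-comm a j))
                           (m≤o∸n⇒m+n≤o j a≤2n (subst (j ≤_) (2n+1∸suc a) j≤bd))
  ... | no a≰2n  = contradiction (subst (j ≤_) (trans (2n+1∸suc a) (m≤n⇒m∸n≡0 (<⇒≤ (≰⇒> a≰2n)))) j≤bd)
                                 (<⇒≱ (≤-trans (s≤s z≤n) a<j))

  within-bound : ∀ {w} → IsDB n w → WithinBound w
  within-bound {w} (len , _) m m≤l = subst (#u (take m w) ≤_) (sym (2n+1∸suc _))
    (m+n≤o⇒m≤o∸n (#u (take m w)) (begin
      #u (take m w) + #r (take m w) ≡⟨ +-comm (#u (take m w)) _ ⟩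
      #r (take m w) + #u (take m w) ≡⟨ #r-take+#u-take m w m≤l ⟩
      m                             ≤⟨ subst (m ≤_) len m≤l ⟩
      2 * n                         ∎))
    where open ≤-Reasoning

  preimage : ∀ J → Σ Word λ w → IsDB n w × idealOf w ≈I J
  preimage J = greedy (2 * n) , (length-letters _ 0 , greedy-ballot _) , idealOf-greedy cells-fit
    where open Greedy (∸-monoʳ-≤ (2 * n + 1)) J

  isOrderIsomorphismB : IsOrderIsomorphism _≈W_ _≈I_ _≤W_ _⊆I_ (λ (x : DB n) → idealOf (proj₁ x))
  isOrderIsomorphismB = isOrderIsomorphism (2 * n) proj₁ proj₂ within-bound preimage

proposition2p21 : (n : ℕ) → 0 < n →
    Σ (DA n → Ideal (TA n)) (IsOrderIsomorphism _≈W_ _≈I_ _≤W_ _⊆I_)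
    × Σ (DB n → Ideal (TB n)) (IsOrderIsomorphism _≈W_ _≈I_ _≤W_ _⊆I_)
proposition2p21 n _ = (_ , TypeA.isOrderIsomorphismA n) , (_ , TypeB.isOrderIsomorphismB n)
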